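{- Let $\mathcal P=\langle\mathcal S,\mathcal W,\mathcal Q,\mathcal T\rangle$ be a complexity problem, let $(\succsim,\succ)$ be a $\mathcal P$-monotone complexity pair such that $\succ$ is $G$-collapsible on $\mathcal P$ for a map $G$ from terms to $\mathbb N$, and suppose $\mathcal W\subseteq{\succsim}$ and $\mathcal S\subseteq{\succ}$. Then for every $t\in\mathcal T$, $\mathrm{dh}(t,\to^{\mathcal Q}_{\mathcal S/\mathcal W})$ is defined and $\mathrm{dh}(t,\to^{\mathcal Q}_{\mathcal S/\mathcal W})\le G(t)$.
   Context: Terms are built from a signature $\mathcal F$ and a countably infinite set of variables $\mathcal V$. For TRSs $\mathcal Q,\mathcal R$ write $s\to^{\mathcal Q}_{\mathcal R}t$ iff there are a context $C$, a substitution $\sigma$ and a rule $f(l_1,\dots,l_n)\to r\in\mathcal R$ with $s=C[f(l_1\sigma,\dots,l_n\sigma)]$, $t=C[r\sigma]$, and every $l_i\sigma$ is a normal form of $\mathcal Q$. The relative relation is ${\to^{\mathcal Q}_{\mathcal S/\mathcal W}}=(\to^{\mathcal Q}_{\mathcal W})^*\cdot\to^{\mathcal Q}_{\mathcal S}\cdot(\to^{\mathcal Q}_{\mathcal W})^*$. The derivation height is $\mathrm{dh}(t,\to)=\max\{n\mid\exists t_1,\dots,t_n.\ t\to t_1\to\cdots\to t_n\}$, a partial function (undefined when no maximum exists). A complexity problem $\mathcal P=\langle\mathcal S,\mathcal W,\mathcal Q,\mathcal T\rangle$ consists of TRSs $\mathcal S$ (strict rules), $\mathcal W$ (weak rules),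 $\mathcal Q$ and a set of terms $\mathcal T$; $\to_{\mathcal P}$ denotes $\to^{\mathcal Q}_{\mathcal S\cup\mathcal W}$ and $\to_{\mathcal P}^*(\mathcal T)$ the set of terms reachable from $\mathcal T$ by $\to_{\mathcal P}$. Replacement maps: $\mu$ assigns to each $n$-ary $f$ a set $\mu(f)\subseteq\{1,\dots,n\}$; $\mathrm{Pos}_\mu(x)=\{\varepsilon\}$ for variables, $\mathrm{Pos}_\mu(f(t_1,\dots,t_n))=\{\varepsilon\}\cup\{i\cdot p\mid i\in\mu(f),p\in\mathrm{Pos}_\mu(t_i)\}$; $\mathcal T_\mu(\to)$ is the set of terms $s$ such that every position $p$ with $s|_p$ not a $\to$-normal form lies in $\mathrm{Pos}_\mu(s)$; $\mu$ is a usable replacement map for a TRS $\mathcal R$ in $\mathcal P$ if $\to_{\mathcal P}^*(\mathcal T)\subseteq\mathcal T_\mu(\to^{\mathcal Q}_{\mathcal R})$. A relation $R$ is $\mu$-monotone if $i\in\mu(f)$ and $s_i\mathrel R t_i$ imply $f(\dots,s_i,\dots)\mathrel R f(\dots,t_i,\dots)$. A complexity pair is a pair $(\succsim,\succ)$ where $\succsim$ is a preorder and $\succ$ an (irreflexive, transitive) order, both stable under substitutions, with ${\succsim}\cdot{\succ}\cdot{\succsim}\subseteq{\succ}$. It is $\mathcal P$-monotone if $\succsim$ is $\mu_{\mathcal W}$-monotone for some usable replacement map $\mu_{\mathcal W}$ for $\mathcal W$ in $\mathcal P$ and $\succ$ is $\mu_{\mathcal S}$-monotone for some usable replacement map $\mu_{\mathcal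 S}$ for $\mathcal S$ in $\mathcal P$. For $G$ mapping terms to $\mathbb N$, $\succ$ is $G$-collapsible on $\mathcal P$ if for all $s\in\to_{\mathcal P}^*(\mathcal T)$ and all $t$, $s\to^{\mathcal Q}_{\mathcal S/\mathcal W}t$ and $s\succ t$ imply $G(s)>G(t)$. $\mathcal R\subseteq{\succ}$ means $l\succ r$ for all rules $l\to r\in\mathcal R$. -}

module Defs where

open import Data.Nat using (ℕ; zero; suc; _≤_; _<_; _>_)
open import Data.Fin using (Fin; toℕ)
open import Data.Vec using (Vec; []; _∷_; lookup; _[_]≔_)
open import Data.List using (List; []; _∷_)
open import Data.Vec.Relation.Unary.All using (All)
open import Data.Product using (Σ; _×_; ∃)
open import Data.Unit using (⊤)
open import Relation.Nullary using (¬_)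
open import Relation.Binary.Construct.Closure.ReflexiveTransitive using (Star)
open import Data.Sum using (_⊎_)

record Signature : Set₁ where
  field
    Sym   : Set
    arity : Sym → ℕ

module Terms (Σsig : Signature) where
  open Signature Σsig

  Var : Set
  Var = ℕ

  data Term : Set where
    var : Var → Term
    fun : (f : Sym) → Vec Term (arity f) → Term

  Subst : Set
  Subst = Var → Term

  mutual
    _·_ : Term → Subst → Term
    var x    · σ = σ x
    fun f ts · σ = fun f (ts ·s σ)

    _·s_ : ∀ {n} → Vec Term n → Subst → Vec Term n
    []       ·s σ = []
    (t ∷ ts) ·s σ = (t · σ) ∷ (ts ·s σ)

  Rel : Set₁
  Rel = Term → Term → Set

  TRS : Set₁
  TRS = Term → Term → Set

  -- Rewrite step of R where the arguments of the redex must satisfy Ok.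
  -- The closure under contexts C is given by the `arg` constructor.
  data RStep (Ok : Term → Set) (R : TRS) : Rel where
    root : ∀ {f} {ls : Vec Term (arity f)} {r} (σ : Subst) →
           R (fun f ls) r → All Ok (ls ·s σ) →
           RStep Ok R (fun f (ls ·s σ)) (r · σ)
    arg  : ∀ {f} (ts : Vec Term (arity f)) (i : Fin (arity f)) {u} →
           RStep Ok R (lookup ts i) u →
           RStep Ok R (fun f ts) (fun f (ts [ i ]≔ u))

  NF : Rel → Term → Set
  NF R t = ∀ u → ¬ R t u

  NFof : TRS → Term → Set
  NFof Q = NF (RStep (λ _ → ⊤) Q)

  QStep : TRS → TRS → Rel
  QStep Q R = RStep (NFof Q) R

  _∪ᵀ_ : TRS → TRS → TRS
  (R ∪ᵀ R') l r = R l r ⊎ R' l r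

  _⨾_ : Rel → Rel → Rel
  (R ⨾ R') s u = ∃ λ t → R s t × R' t u

  RelStep : TRS → TRS → TRS → Rel
  RelStep Q S W = (Star (QStep Q W) ⨾ (QStep Q S)) ⨾ Star (QStep Q W)

  data Chain (R : Rel) : ℕ → Term → Set where
    done : ∀ {t} → Chain R zero t
    step : ∀ {n t u} → R t u → Chain R n u → Chain R (suc n) t

  -- IsDH R t n : dh(t, R) is defined and equals n (n is the maximum).
  IsDH : Rel → Term → ℕ → Set
  IsDH R t n = Chain R n t × (∀ m → Chain R m t → m ≤ n)

  record Problem : Set₁ where
    field
      S W Q : TRS
      T     : Term → Set

  module _ (P : Problem) where
    open Problem P

    StepP : Rel
    StepP = QStep Q (S ∪ᵀ W)

    Reachable : Term → Set
    Reachable s = ∃ λ t → T t × Star StepP t s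

  ReplMap : Set₁
  ReplMap = (f : Sym) → Fin (arity f) → Set

  Position : Set
  Position = List ℕ

  -- AtPos s p u : s|_p = u   (argument indices 0-based)
  data AtPos : Term → Position → Term → Set where
    here  : ∀ {t} → AtPos t [] t
    there : ∀ {f} {ts : Vec Term (arity f)} (i : Fin (arity f)) {p u} →
            AtPos (lookup ts i) p u → AtPos (fun f ts) (toℕ i ∷ p) u

  data PosMu (μ : ReplMap) : Term → Position → Set where
    root : ∀ {t} → PosMu μ t []
    arg  : ∀ {f} {ts : Vec Term (arity f)} (i : Fin (arity f)) {p} →
           μ f i → PosMu μ (lookup ts i) p → PosMu μ (fun f ts) (toℕ i ∷ p)

  InTμ : ReplMap → Rel → Term → Set
  InTμ μ R s = ∀ p u → AtPos s p u → ¬ NF R u → PosMu μ s p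

  Usable : Problem → ReplMap → TRS → Set
  Usable P μ R = ∀ s → Reachable P s → InTμ μ (QStep (Problem.Q P) R) s

  MuMonotone : ReplMap → Rel → Set
  MuMonotone μ R = ∀ f (ts : Vec Term (arity f)) (i : Fin (arity f)) u →
                   μ f i → R (lookup ts i) u → R (fun f ts) (fun f (ts [ i ]≔ u))

  Stable : Rel → Set
  Stable R = ∀ s t (σ : Subst) → R s t → R (s · σ) (t · σ)

  record IsComplexityPair (≿ ≻ : Rel) : Set where
    field
      ≿-refl   : ∀ s → ≿ s s
      ≿-trans  : ∀ {s t u} → ≿ s t → ≿ t u → ≿ s u
      ≻-irrefl : ∀ s → ¬ ≻ s s
      ≻-trans  : ∀ {s t u} → ≻ s t → ≻ t u → ≻ s u
      ≿-stable : Stable ≿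
      ≻-stable : Stable ≻
      compat   : ∀ {s s' t' t} → ≿ s s' → ≻ s' t' → ≿ t' t → ≻ s t

  PMonotone : Problem → Rel → Rel → Set₁
  PMonotone P ≿ ≻ =
    (Σ ReplMap λ μW → Usable P μW (Problem.W P) × MuMonotone μW ≿) ×
    (Σ ReplMap λ μS → Usable P μS (Problem.S P) × MuMonotone μS ≻)

  Collapsible : Problem → (Term → ℕ) → Rel → Set
  Collapsible P G ≻ = ∀ s t → Reachable P s →
    RelStep (Problem.Q P) (Problem.S P) (Problem.W P) s t → ≻ s t → G s > G t

  _⊆ʳ_ : TRS → Rel → Set
  R ⊆ʳ ≻ = ∀ l r → R l r → ≻ l r

-- Every relative step from a reachable term is contained in ≻: the weak steps are
-- oriented by ≿ and the strict step by ≻ (by μ-monotonicity, since usability puts every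
-- redex at a μ-replacing position), and compatibility merges them. Reachability is
-- preserved along the way, so collapsibility makes G drop strictly at each relative step
-- and every derivation from t has length at most G t. A longest derivation then exists,
-- but only classically: its length is found by searching downwards from G t.
module Submission where

open import Defs
open import Data.Nat using (ℕ; zero; suc; _≤_; z≤n; s≤s)
open import Data.Nat.Properties using (≤-refl; ≤-trans; ≤-pred; ≤∧≢⇒<; m≤n⇒m≤1+n)
open import Data.Fin using (Fin; toℕ)
open import Data.Fin.Properties using (toℕ-injective)
open import Data.Vec using (Vec; lookup)
open import Data.List using ([]; _∷_)
open import Data.List.Properties using (∷-injectiveˡ; ∷-injectiveʳ)
open import Data.Product using (Σ; _×_; _,_; proj₁; proj₂)
open import Data.Sum using (inj₁; inj₂)
open import Relation.Nullary using (¬_; yes; no)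
open import Relation.Nullary.Decidable using (¬¬-excluded-middle)
open import Relation.Binary.PropositionalEquality using (_≡_; refl)
open import Relation.Binary.Construct.Closure.ReflexiveTransitive using (Star; ε; _◅_; _◅◅_)

¬¬-maximum : {P : ℕ → Set} (k : ℕ) → P 0 → (∀ m → P m → m ≤ k) →
             ¬ ¬ (Σ ℕ λ n → (P n × (∀ m → P m → m ≤ n)) × n ≤ k)
¬¬-maximum zero    p₀ bounded noMax = noMax (0 , (p₀ , bounded) , z≤n)
¬¬-maximum {P} (suc k) p₀ bounded noMax = ¬¬-excluded-middle λ
  { (yes pk) → noMax (suc k , (pk , bounded) , ≤-refl)
  ; (no ¬pk) → ¬¬-maximum k p₀ (boundedBy-k ¬pk)
                 (λ { (n , isMax , n≤k) → noMax (n , isMax , m≤n⇒m≤1+n n≤k) }) }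
  where
  boundedBy-k : ¬ P (suc k) → ∀ m → P m → m ≤ k
  boundedBy-k ¬pk m pm = ≤-pred (≤∧≢⇒< (bounded m pm) λ { refl → ¬pk pm })

module _ {Σsig : Signature} where
  open Terms Σsig
  open Signature Σsig

  PosMu-arg⁻¹ : ∀ {μ f} {ts : Vec Term (arity f)} (i : Fin (arity f)) {p} →
                PosMu μ (fun f ts) (toℕ i ∷ p) → μ f i × PosMu μ (lookup ts i) p
  PosMu-arg⁻¹ {μ} {f} {ts} i {p} pos = invert pos refl
    where
    invert : ∀ {q} → PosMu μ (fun f ts) q → q ≡ toℕ i ∷ p → μ f i × PosMu μ (lookup ts i) p
    invert (arg j μfj posʲ) eq with toℕ-injective (∷-injectiveˡ eq) | ∷-injectiveʳ eq
    ... | refl | refl = μfj , posʲ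

  InTμ-arg : ∀ {μ R f} {ts : Vec Term (arity f)} (i : Fin (arity f)) →
             InTμ μ R (fun f ts) → ¬ NF R (lookup ts i) →
             μ f i × InTμ μ R (lookup ts i)
  InTμ-arg {ts = ts} i inT reducible =
    proj₁ (PosMu-arg⁻¹ i (inT (toℕ i ∷ []) (lookup ts i) (there i here) reducible)) ,
    λ p u at reducibleᵘ → proj₂ (PosMu-arg⁻¹ i (inT (toℕ i ∷ p) u (there i at) reducibleᵘ))

  QStep⊆-onTμ : ∀ {μ Q R} {≾ : Rel} → MuMonotone μ ≾ → Stable ≾ → R ⊆ʳ ≾ →
                ∀ {s u} → InTμ μ (QStep Q R) s → QStep Q R s u → ≾ s u
  QStep⊆-onTμ mono stable R⊆ inT (root {ls = ls} {r} σ lr _) = stable (fun _ ls) r σ (R⊆ _ _ lr)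
  QStep⊆-onTμ mono stable R⊆ inT (arg ts i {u} st) =
    let μfi , inTⁱ = InTμ-arg i inT (λ nf → nf u st)
    in mono _ ts i u μfi (QStep⊆-onTμ mono stable R⊆ inTⁱ st)

  RStep-map : ∀ {Ok} {R R' : TRS} → (∀ l r → R l r → R' l r) →
              ∀ {s u} → RStep Ok R s u → RStep Ok R' s u
  RStep-map R⊆R' (root σ lr ok) = root σ (R⊆R' _ _ lr) ok
  RStep-map R⊆R' (arg ts i st)  = arg ts i (RStep-map R⊆R' st)

  module Oriented (P : Problem) {≿ ≻ : Rel} (cp : IsComplexityPair ≿ ≻)
    {μW μS : ReplMap}
    (usableW : Usable P μW (Problem.W P)) (monoW : MuMonotone μW ≿)
    (usableS : Usable P μS (Problem.S P)) (monoS : MuMonotone μS ≻)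
    (W⊆ : Problem.W P ⊆ʳ ≿) (S⊆ : Problem.S P ⊆ʳ ≻) where
    open Problem P
    open IsComplexityPair cp

    Reachable-step : ∀ {R s u} → (∀ l r → R l r → (S ∪ᵀ W) l r) →
                     Reachable P s → QStep Q R s u → Reachable P u
    Reachable-step R⊆ (t , t∈T , t→*s) s→u = t , t∈T , (t→*s ◅◅ (RStep-map R⊆ s→u ◅ ε))

    weakSteps⇒≿ : ∀ {s u} → Reachable P s → Star (QStep Q W) s u → ≿ s u × Reachable P u
    weakSteps⇒≿ reach ε = ≿-refl _ , reach
    weakSteps⇒≿ {s} reach (s→t ◅ t→*u) =
      let t≿u , reachᵘ = weakSteps⇒≿ (Reachable-step (λ _ _ → inj₂) reach s→t) t→*u
      in ≿-trans (QStep⊆-onTμ monoW ≿-stable W⊆ (usableW s reach) s→t) t≿u , reachᵘ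

    RelStep⇒≻ : ∀ {s u} → Reachable P s → RelStep Q S W s u → ≻ s u × Reachable P u
    RelStep⇒≻ reach (t' , (t , s→*t , t→t') , t'→*u) =
      let s≿t , reachᵗ = weakSteps⇒≿ reach s→*t
          t≻t' = QStep⊆-onTμ monoS ≻-stable S⊆ (usableS t reachᵗ) t→t'
          t'≿u , reachᵘ = weakSteps⇒≿ (Reachable-step (λ _ _ → inj₁) reachᵗ t→t') t'→*u
      in compat s≿t t≻t' t'≿u , reachᵘ

    Chain-length≤G : ∀ {G} → Collapsible P G ≻ →
                     ∀ {m s} → Reachable P s → Chain (RelStep Q S W) m s → m ≤ G s
    Chain-length≤G collapsible reach done = z≤n
    Chain-length≤G collapsible {s = s} reach (step {u = u} s→u chain) =
      let s≻u , reachᵘ = RelStep⇒≻ reach s→u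
      in ≤-trans (s≤s (Chain-length≤G collapsible reachᵘ chain)) (collapsible s u reach s→u s≻u)

mainTheorem2 : (Σsig : Signature) → let open Terms Σsig in
    (P : Problem) (≿ ≻ : Rel) (G : Term → ℕ) →
    IsComplexityPair ≿ ≻ → PMonotone P ≿ ≻ → Collapsible P G ≻ →
    Problem.W P ⊆ʳ ≿ → Problem.S P ⊆ʳ ≻ →
    ∀ t → Problem.T P t →
    ¬ ¬ (Σ ℕ λ n → IsDH (RelStep (Problem.Q P) (Problem.S P) (Problem.W P)) t n × n ≤ G t)
mainTheorem2 Σsig P ≿ ≻ G cp ((_ , usableW , monoW) , (_ , usableS , monoS)) collapsible W⊆ S⊆ t t∈T =
  ¬¬-maximum (G t) done (λ m → Chain-length≤G collapsible (t , t∈T , ε))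
  where
  open Terms Σsig
  open Oriented P cp usableW monoW usableS monoS W⊆ S⊆
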